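{- Let $Q$ be a commutative involutive quantale and $X$ a set. The set $\mathbf{E}=\{q\bullet\mathrm{id}_X : q\in Q\}\subseteq\mathrm{Hom}(X,X)$ is an object of $\mathbf{Rel}_Q\text{ - }\mathbf{Alg}_{\mathrm{vN}}(X)$.
   Context: A commutative involutive quantale $Q$ is a complete join-semilattice with a commutative monoid operation $\cdot$ (unit $1_Q$) distributing over arbitrary joins, and a join-preserving involution ${}^*$ with $(xy)^*=y^*x^*$, $1_Q^*=1_Q$; its least element is $0\neq\top$. In $\mathbf{Rel}_Q$, objects are sets, morphisms $X\to Y$ are functions $X\times Y\to Q$, composition $(g\circ f)(x,z)=\bigvee_y f(x,y)g(y,z)$, identities $\mathrm{id}_X(x,y)=1_Q$ iff $x=y$ (else $0$), dagger $f^\dagger(y,x)=f(x,y)^*$; scalar multiplication $(q\bullet f)(x,y)=q\cdot f(x,y)$. $\mathbf{Rel}_Q\text{ - }\mathbf{Alg}_{\mathrm{vN}}(X)$ has as objects the subsets $\mathbf{A}\subseteq\mathrm{Hom}(X,X)$ containing the zero map and $\mathrm{id}_X$, closed under binary pointwise joins, composition, scalar multiplication and $\dagger$, commutative under composition, and satisfying $\mathbf{A}=\mathbf{A}''$, where $B'=\{f:f\circ g=g\circ f\ \forall g\in B\}$. -}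

module Defs where

open import Level using (Level; Lift; lift; lower) renaming (suc to lsuc)
open import Data.Bool using (Bool; true; false; if_then_else_)
open import Data.Product using (Σ; _×_; _,_)
open import Relation.Binary.PropositionalEquality using (_≡_)
open import Relation.Nullary using (¬_)
open import Data.Empty using (⊥)

-- The carrier lives in Set ℓ, and arbitrary
-- joins are taken over families indexed by any type in Set ℓ (so in particular
-- over the carrier itself and over the sets X considered below, which also
-- live in Set ℓ).
record CIQuantale (ℓ : Level) : Set (lsuc ℓ) where
  infixl 7 _·_
  infix 4 _≤_
  field
    Carrier : Set ℓ
    _≤_       : Carrier → Carrier → Set ℓ
    ≤-refl    : ∀ {x} → x ≤ x
    ≤-trans   : ∀ {x y z} → x ≤ y → y ≤ z → x ≤ z
    ≤-antisym : ∀ {x y} → x ≤ y → y ≤ x → x ≡ y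
    ⋁         : {I : Set ℓ} → (I → Carrier) → Carrier
    ⋁-upper   : ∀ {I : Set ℓ} (f : I → Carrier) (i : I) → f i ≤ ⋁ f
    ⋁-least   : ∀ {I : Set ℓ} (f : I → Carrier) (u : Carrier) →
                (∀ i → f i ≤ u) → ⋁ f ≤ u
    _·_       : Carrier → Carrier → Carrier
    1Q        : Carrier
    ·-assoc   : ∀ x y z → (x · y) · z ≡ x · (y · z)
    ·-comm    : ∀ x y → x · y ≡ y · x
    ·-identityˡ : ∀ x → 1Q · x ≡ x
    ·-distrib-⋁ : ∀ x {I : Set ℓ} (f : I → Carrier) → x · ⋁ f ≡ ⋁ (λ i → x · f i)
    _*        : Carrier → Carrier
    *-involutive : ∀ x → (x *) * ≡ x
    *-⋁       : ∀ {I : Set ℓ} (f : I → Carrier) → (⋁ f) * ≡ ⋁ (λ i → f i *)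
    *-·       : ∀ x y → (x · y) * ≡ (y *) · (x *)
    *-1       : 1Q * ≡ 1Q

    0≢⊤ : ¬ (⋁ {I = Lift ℓ ⊥} (λ ()) ≡ ⋁ {I = Carrier} (λ x → x))

  0Q : Carrier
  0Q = ⋁ {I = Lift ℓ ⊥} (λ ())

  ⊤Q : Carrier
  ⊤Q = ⋁ {I = Carrier} (λ x → x)

  _∨_ : Carrier → Carrier → Carrier
  x ∨ y = ⋁ {I = Lift ℓ Bool} (λ b → if lower b then x else y)

module RelQ {ℓ : Level} (Q : CIQuantale ℓ) where
  open CIQuantale Q

  Hom : Set ℓ → Set ℓ → Set ℓ
  Hom X Y = X → Y → Carrier

  infix 4 _≐_
  _≐_ : ∀ {X Y} → Hom X Y → Hom X Y → Set ℓ
  f ≐ g = ∀ x y → f x y ≡ g x y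

  infixr 9 _∘_
  _∘_ : ∀ {X Y Z} → Hom Y Z → Hom X Y → Hom X Z
  (g ∘ f) x z = ⋁ (λ y → f x y · g y z)

  -- identity: 1_Q if x = y, 0 otherwise (written as the join over proofs of x ≡ y)
  idR : ∀ X → Hom X X
  idR X x y = ⋁ {I = x ≡ y} (λ _ → 1Q)

  zeroR : ∀ X Y → Hom X Y
  zeroR X Y _ _ = 0Q

  _† : ∀ {X Y} → Hom X Y → Hom Y X
  (f †) y x = (f x y) *

  infixr 8 _•_
  _•_ : ∀ {X Y} → Carrier → Hom X Y → Hom X Y
  (q • f) x y = q · f x y

  _∨ᴴ_ : ∀ {X Y} → Hom X Y → Hom X Y → Hom X Y
  (f ∨ᴴ g) x y = f x y ∨ g x y

  Subset : Set ℓ → Set (lsuc ℓ)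
  Subset X = Hom X X → Set ℓ

  _′ : ∀ {X} → Subset X → Subset X
  (B ′) f = ∀ g → B g → (f ∘ g) ≐ (g ∘ f)

  record IsVNAlgebra (X : Set ℓ) (A : Subset X) : Set (lsuc ℓ) where
    field
      has-zero : A (zeroR X X)
      has-id   : A (idR X)
      ∨-closed : ∀ f g → A f → A g → A (f ∨ᴴ g)
      ∘-closed : ∀ f g → A f → A g → A (g ∘ f)
      •-closed : ∀ q f → A f → A (q • f)
      †-closed : ∀ f → A f → A (f †)
      commutative : ∀ f g → A f → A g → (f ∘ g) ≐ (g ∘ f)
      bicommutant : ∀ f → (A f → ((A ′) ′) f) × (((A ′) ′) f → A f)

  E : (X : Set ℓ) → Subset X
  E X f = Σ Carrier (λ q → f ≐ (q • idR X))

module Submission where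

-- Scalar multiples of the identity are central in Hom(X,X), since composition is Q-bilinear;
-- this gives closure under composition and commutativity, and shows that E′ is all of
-- Hom(X,X), so that E″ is the centre of Hom(X,X). A central f commutes in particular with
-- every matrix unit e_ab(y,w) = δ(y,a)·δ(b,w), which forces f(x,z) = f(w,w)·δ(x,z) for
-- every w; hence f = (⋁_w f(w,w)) • id and E″ = E.

open import Level using (Level; lift)
open import Data.Bool using (true; false)
open import Data.Product using (_,_)
open import Relation.Binary.PropositionalEquality
  using (_≡_; refl; sym; trans; cong; cong₂; module ≡-Reasoning)
open import Defs

module QuantaleProperties {ℓ : Level} (Q : CIQuantale ℓ) where
  open CIQuantale Q

  ≡⇒≤ : ∀ {x y} → x ≡ y → x ≤ y
  ≡⇒≤ refl = ≤-refl

  ⋁-cong : ∀ {I : Set ℓ} {f g : I → Carrier} → (∀ i → f i ≡ g i) → ⋁ f ≡ ⋁ g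
  ⋁-cong {f = f} {g} f≗g = ≤-antisym
    (⋁-least f (⋁ g) (λ i → ≤-trans (≡⇒≤ (f≗g i)) (⋁-upper g i)))
    (⋁-least g (⋁ f) (λ i → ≤-trans (≡⇒≤ (sym (f≗g i))) (⋁-upper f i)))

  ⋁-const : ∀ {I : Set ℓ} (c : Carrier) → I → ⋁ {I = I} (λ _ → c) ≡ c
  ⋁-const c i = ≤-antisym (⋁-least _ c (λ _ → ≤-refl)) (⋁-upper (λ _ → c) i)

  ·-identityʳ : ∀ x → x · 1Q ≡ x
  ·-identityʳ x = trans (·-comm x 1Q) (·-identityˡ x)

  ·-distribʳ-⋁ : ∀ x {I : Set ℓ} (f : I → Carrier) → ⋁ f · x ≡ ⋁ (λ i → f i · x)
  ·-distribʳ-⋁ x f =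
    trans (·-comm (⋁ f) x) (trans (·-distrib-⋁ x f) (⋁-cong (λ i → ·-comm x (f i))))

  ·-zeroˡ : ∀ x → 0Q · x ≡ 0Q
  ·-zeroˡ x = trans (·-distribʳ-⋁ x (λ ())) (⋁-cong (λ ()))

  ·-distribʳ-∨ : ∀ x y z → (x ∨ y) · z ≡ (x · z) ∨ (y · z)
  ·-distribʳ-∨ x y z =
    trans (·-distribʳ-⋁ z _) (⋁-cong λ { (lift true) → refl ; (lift false) → refl })

module RelQProperties {ℓ : Level} (Q : CIQuantale ℓ) where
  open CIQuantale Q
  open QuantaleProperties Q
  open RelQ Q

  ≐-refl : ∀ {X Y} {f : Hom X Y} → f ≐ f
  ≐-refl x y = refl

  ≐-sym : ∀ {X Y} {f g : Hom X Y} → f ≐ g → g ≐ f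
  ≐-sym f≐g x y = sym (f≐g x y)

  ≐-trans : ∀ {X Y} {f g h : Hom X Y} → f ≐ g → g ≐ h → f ≐ h
  ≐-trans f≐g g≐h x y = trans (f≐g x y) (g≐h x y)

  ∘-cong : ∀ {X Y Z} {f f′ : Hom X Y} {g g′ : Hom Y Z} →
           f ≐ f′ → g ≐ g′ → (g ∘ f) ≐ (g′ ∘ f′)
  ∘-cong f≐f′ g≐g′ x z = ⋁-cong (λ y → cong₂ _·_ (f≐f′ x y) (g≐g′ y z))

  •-assoc : ∀ {X Y} p q (f : Hom X Y) → (p • q • f) ≐ ((p · q) • f)
  •-assoc p q f x y = sym (·-assoc p q (f x y))

  idR-refl : ∀ {X} (x : X) → idR X x x ≡ 1Q
  idR-refl x = ⋁-const 1Q refl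

  idR-sym : ∀ {X} (x y : X) → idR X x y ≡ idR X y x
  idR-sym x y = ≤-antisym
    (⋁-least _ _ (λ x≡y → ⋁-upper _ (sym x≡y)))
    (⋁-least _ _ (λ y≡x → ⋁-upper _ (sym y≡x)))

  idR-† : ∀ X → (idR X †) ≐ idR X
  idR-† X y x = trans (*-⋁ _) (trans (⋁-cong (λ _ → *-1)) (idR-sym x y))

  ·-idR : ∀ {X} c (y z : X) → c · idR X y z ≡ ⋁ {I = y ≡ z} (λ _ → c)
  ·-idR c y z = trans (·-distrib-⋁ c _) (⋁-cong (λ _ → ·-identityʳ c))

  idR-siftʳ : ∀ {X} (h : X → Carrier) (z : X) → ⋁ (λ y → h y · idR X y z) ≡ h z
  idR-siftʳ {X} h z = ≤-antisym
    (⋁-least _ _ (λ y → ≤-trans (≡⇒≤ (·-idR (h y) y z)) (⋁-least _ _ λ { refl → ≤-refl })))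
    (≤-trans (≡⇒≤ (sym (trans (cong (h z ·_) (idR-refl z)) (·-identityʳ (h z)))))
             (⋁-upper (λ y → h y · idR X y z) z))

  idR-siftˡ : ∀ {X} (h : X → Carrier) (x : X) → ⋁ (λ y → idR X x y · h y) ≡ h x
  idR-siftˡ h x =
    trans (⋁-cong (λ y → trans (·-comm _ _) (cong (h y ·_) (idR-sym x y)))) (idR-siftʳ h x)

  •-idR-∘ : ∀ {X Y} q (f : Hom X Y) → ((q • idR Y) ∘ f) ≐ (q • f)
  •-idR-∘ q f x z =
    trans (⋁-cong (λ y → sym (·-assoc (f x y) q _)))
          (trans (idR-siftʳ (λ y → f x y · q) z) (·-comm _ _))

  ∘-•-idR : ∀ {X Y} q (f : Hom X Y) → (f ∘ (q • idR X)) ≐ (q • f)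
  ∘-•-idR q f x z =
    trans (⋁-cong (λ y → trans (cong (_· f y z) (·-comm q _)) (·-assoc _ q _)))
          (idR-siftˡ (λ y → q · f y z) x)

  •-idR-central : ∀ {X} q (f : Hom X X) → ((q • idR X) ∘ f) ≐ (f ∘ (q • idR X))
  •-idR-central q f = ≐-trans (•-idR-∘ q f) (≐-sym (∘-•-idR q f))

  matrixUnit : ∀ {X} → X → X → Hom X X
  matrixUnit {X} a b y w = idR X y a · idR X b w

  matrixUnit-∘ : ∀ {X} (f : Hom X X) (a b x z : X) →
                 (matrixUnit a b ∘ f) x z ≡ f x a · idR X b z
  matrixUnit-∘ {X} f a b x z =
    trans (⋁-cong (λ y → trans (cong (f x y ·_) (·-comm (idR X y a) _))
                               (sym (·-assoc (f x y) _ _))))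
          (idR-siftʳ (λ y → f x y · idR X b z) a)

  ∘-matrixUnit : ∀ {X} (f : Hom X X) (a b x z : X) →
                 (f ∘ matrixUnit a b) x z ≡ idR X x a · f b z
  ∘-matrixUnit {X} f a b x z =
    trans (⋁-cong (λ y → trans (cong (_· f y z) (·-comm (idR X x a) _))
                               (·-assoc _ (idR X x a) (f y z))))
          (idR-siftˡ (λ y → idR X x a · f y z) b)

  commutes-with-matrixUnits⇒scalar :
    ∀ {X} (f : Hom X X) → (∀ a b → (f ∘ matrixUnit a b) ≐ (matrixUnit a b ∘ f)) →
    f ≐ (⋁ (λ w → f w w) • idR X)
  commutes-with-matrixUnits⇒scalar {X} f commutes x z = sym (begin
    ⋁ (λ w → f w w) · idR X x z    ≡⟨ ·-distribʳ-⋁ (idR X x z) (λ w → f w w) ⟩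
    ⋁ (λ w → f w w · idR X x z)    ≡⟨ ⋁-cong entry-via-diagonal ⟩
    ⋁ {I = X} (λ _ → f x z)        ≡⟨ ⋁-const (f x z) x ⟩
    f x z                          ∎)
    where
    open ≡-Reasoning
    entry-via-diagonal : ∀ w → f w w · idR X x z ≡ f x z
    entry-via-diagonal w = begin
      f w w · idR X x z            ≡⟨ ·-comm _ _ ⟩
      idR X x z · f w w            ≡⟨ sym (∘-matrixUnit f z w x w) ⟩
      (f ∘ matrixUnit z w) x w     ≡⟨ commutes z w x w ⟩
      (matrixUnit z w ∘ f) x w     ≡⟨ matrixUnit-∘ f z w x w ⟩
      f x z · idR X w w            ≡⟨ cong (f x z ·_) (idR-refl w) ⟩
      f x z · 1Q                   ≡⟨ ·-identityʳ (f x z) ⟩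
      f x z                        ∎

module ScalarAlgebra {ℓ : Level} (Q : CIQuantale ℓ) (X : Set ℓ) where
  open CIQuantale Q
  open QuantaleProperties Q
  open RelQ Q
  open RelQProperties Q

  E-zero : E X (zeroR X X)
  E-zero = 0Q , λ x y → sym (·-zeroˡ _)

  E-id : E X (idR X)
  E-id = 1Q , λ x y → sym (·-identityˡ _)

  E-∨ : ∀ {f g} → E X f → E X g → E X (f ∨ᴴ g)
  E-∨ (p , f≐) (r , g≐) =
    (p ∨ r) , λ x y → trans (cong₂ _∨_ (f≐ x y) (g≐ x y)) (sym (·-distribʳ-∨ p r _))

  E-∘ : ∀ {f g} → E X f → E X g → E X (g ∘ f)
  E-∘ (p , f≐) (r , g≐) =
    (r · p) , ≐-trans (∘-cong f≐ g≐) (≐-trans (•-idR-∘ r (p • idR X)) (•-assoc r p (idR X)))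

  E-• : ∀ q {f} → E X f → E X (q • f)
  E-• q (p , f≐) = (q · p) , λ x y → trans (cong (q ·_) (f≐ x y)) (•-assoc q p (idR X) x y)

  E-† : ∀ {f} → E X f → E X (f †)
  E-† {f} (p , f≐) = (p *) , λ x y → begin
    f y x *                    ≡⟨ cong _* (f≐ y x) ⟩
    (p · idR X y x) *          ≡⟨ *-· p _ ⟩
    (idR X y x *) · (p *)      ≡⟨ cong (_· (p *)) (idR-† X x y) ⟩
    idR X x y · (p *)          ≡⟨ ·-comm _ _ ⟩
    (p *) · idR X x y          ∎
    where open ≡-Reasoning

  E-central : ∀ {f} g → E X f → (f ∘ g) ≐ (g ∘ f)
  E-central g (q , f≐) =
    ≐-trans (∘-cong ≐-refl f≐) (≐-trans (•-idR-central q g) (∘-cong (≐-sym f≐) ≐-refl))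

  E′-universal : ∀ g → (E X ′) g
  E′-universal g f f∈E = ≐-sym (E-central g f∈E)

  E″⊆E : ∀ {f} → ((E X ′) ′) f → E X f
  E″⊆E {f} f∈E″ =
    ⋁ (λ w → f w w) ,
    commutes-with-matrixUnits⇒scalar f (λ a b → f∈E″ (matrixUnit a b) (E′-universal _))

lemma32 : {ℓ : Level} (Q : CIQuantale ℓ) (X : Set ℓ) →
          RelQ.IsVNAlgebra Q X (RelQ.E Q X)
lemma32 Q X = record
  { has-zero    = E-zero
  ; has-id      = E-id
  ; ∨-closed    = λ _ _ → E-∨
  ; ∘-closed    = λ _ _ → E-∘
  ; •-closed    = λ q _ → E-• q
  ; †-closed    = λ _ → E-†
  ; commutative = λ _ g f∈E _ → E-central g f∈E
  ; bicommutant = λ _ → (λ f∈E g _ → E-central g f∈E) , E″⊆E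
  }
  where open ScalarAlgebra Q X
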